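{- For every integer $m\ge1$, every term $w_1\otimes\cdots\otimes w_{m+1}$ of $X\cdot P^m\cdot X\in B^{\otimes(m+1)}$ has $w_1\in\{X,Z\}$.
   Context: Let $\mathcal M=\mathbb Z\langle y,n\rangle/(yn=ny=n,\ n^2=0,\ y^2=y)$. In the ring $\mathcal M\otimes\mathcal M$ (tensor over $\mathbb Z$, with $(a\otimes b)(c\otimes d)=ac\otimes bd$) put $X=y\otimes n+n\otimes y$, $Y=y\otimes y$, $Z=n\otimes n$, and let $B$ be the $\mathbb Z$-span of $X,Y,Z$: a commutative subring, free abelian with basis $X,Y,Z$, with $X^2=2Z$, $Y^2=Y$, $Z^2=0$, $XY=YX=X$, $XZ=ZX=0$, $YZ=ZY=Z$. For $r\ge1$, $B^{\otimes r}$ is free abelian with basis the words $w_1\otimes\cdots\otimes w_r$, $w_i\in\{X,Y,Z\}$; writing $u\in B^{\otimes r}$ uniquely as $\sum_w c_w w$, a term of $u$ is a word $w$ with $c_w\ne0$, and $c_w$ is its coefficient. The chaining product $B^{\otimes r}\times B^{\otimes s}\to B^{\otimes(r+s-1)}$ is the bilinear (associative) map $(a_1\otimes\cdots\otimes a_r)\cdot(b_1\otimes\cdots\otimes b_s)=a_1\otimes\cdots\otimes a_{r-1}\otimes(a_rb_1)\otimes b_2\otimes\cdots\otimes b_s$. Elements of $B$ are regarded as elements of $B^{\otimes1}$. Let $P=X\otimes Y+Y\otimes X\in B^{\otimes2}$ and let $P^m\in B^{\otimes(m+1)}$ be its $m$-fold chaining product. -}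

module Defs where

open import Data.Nat using (ℕ; zero; suc; _+_)
open import Data.Integer using (ℤ; +_; _*_) renaming (_+_ to _+ℤ_)
open import Data.Product using (_×_; _,_)
open import Data.List using (List; []; _∷_; _++_; map; concatMap)
open import Data.Vec using (Vec; []; _∷_)
open import Relation.Nullary using (yes; no)
open import Relation.Binary.PropositionalEquality using (_≡_; refl)
open import Relation.Binary using (DecidableEquality)
import Data.Vec.Properties as VecP

-- The Z-basis X, Y, Z of the ring B.
data L : Set where
  X Y Z : L

_≟L_ : DecidableEquality L
X ≟L X = yes refl
X ≟L Y = no λ ()
X ≟L Z = no λ ()
Y ≟L X = no λ ()
Y ≟L Y = yes refl
Y ≟L Z = no λ ()
Z ≟L X = no λ ()
Z ≟L Y = no λ ()
Z ≟L Z = yes refl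

-- Multiplication table of B on basis elements: a * b = c • l.
-- X²=2Z, Y²=Y, Z²=0, XY=YX=X, XZ=ZX=0, YZ=ZY=Z.
mulL : L → L → ℤ × L
mulL X X = (+ 2 , Z)
mulL X Y = (+ 1 , X)
mulL X Z = (+ 0 , Z)
mulL Y X = (+ 1 , X)
mulL Y Y = (+ 1 , Y)
mulL Y Z = (+ 1 , Z)
mulL Z X = (+ 0 , Z)
mulL Z Y = (+ 1 , Z)
mulL Z Z = (+ 0 , Z)

-- Words of length r (basis of B^{⊗r}).
Word : ℕ → Set
Word r = Vec L r

-- Elements of B^{⊗r}, as finite formal Z-linear combinations of words
-- (a list of (coefficient, word) pairs; the element is their sum).
Tensor : ℕ → Set
Tensor r = List (ℤ × Word r)

coeff : ∀ {r} → Tensor r → Word r → ℤ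
coeff [] w = + 0
coeff ((c , v) ∷ u) w with VecP.≡-dec _≟L_ v w
... | yes _ = c +ℤ coeff u w
... | no _  = coeff u w

-- Chaining product on basis words:
-- (a₁⊗…⊗a_r)·(b₁⊗…⊗b_s) = a₁⊗…⊗a_{r-1}⊗(a_r b₁)⊗b₂⊗…⊗b_s.
chainW : ∀ {a b} → Word (suc a) → Word (suc b) → ℤ × Word (suc (a + b))
chainW {zero} (x ∷ []) (y ∷ ys) with mulL x y
... | (c , l) = (c , l ∷ ys)
chainW {suc a} (x ∷ xs) ys with chainW xs ys
... | (c , v) = (c , x ∷ v)

chain : ∀ {a b} → Tensor (suc a) → Tensor (suc b) → Tensor (suc (a + b))
chain u v = concatMap (λ { (c , w) → map (λ { (d , w') → step c d (chainW w w') }) v }) u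
  where
    step : ∀ {n} → ℤ → ℤ → ℤ × Word n → ℤ × Word n
    step c d (e , w) = (c * d * e , w)

elt : L → Tensor 1
elt l = (+ 1 , l ∷ []) ∷ []

P : Tensor 2
P = (+ 1 , X ∷ Y ∷ []) ∷ (+ 1 , Y ∷ X ∷ []) ∷ []

-- P^m ∈ B^{⊗(m+1)}, m-fold chaining product; P^0 := Y (the unit of B,
-- only used as the base of the recursion, so P^1 = P·Y = P;
-- P^{m+1} = P·P^m, equal to P^m·P by associativity).
Ppow : (m : ℕ) → Tensor (suc m)
Ppow zero = elt Y
Ppow (suc m) = chain P (Ppow m)

XPX : (m : ℕ) → Tensor (suc (m + 0))
XPX m = chain (chain (elt X) (Ppow m)) (elt X)

{-# OPTIONS --safe #-}
-- span{X, Z} is an ideal of B (X² = 2Z, XZ = Z² = 0). Every term of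
-- X·u has its first factor in X·B ⊆ span{X, Z}, and chaining on the right
-- either leaves the first factor alone or multiplies it by an element of B,
-- so it stays in the ideal. A word with nonzero coefficient is a term of the
-- list representing the tensor, hence has the same property.
module Submission where

open import Defs
open import Data.Nat using (ℕ; zero; suc; _≤_; _+_)
open import Data.Integer using (ℤ; +_)
open import Data.Vec using (head; []; _∷_)
open import Data.Empty using (⊥-elim)
open import Data.Sum using (_⊎_; inj₁; inj₂)
open import Data.Product using (_×_; _,_; proj₂)
open import Data.List using ([]; _∷_)
open import Data.List.Relation.Unary.All as All using (All; []; _∷_)
import Data.List.Relation.Unary.All.Properties as All
open import Relation.Nullary using (yes; no)
open import Relation.Binary.PropositionalEquality using (_≡_; _≢_; refl)
import Data.Vec.Properties as Vec

InIdeal : L → Set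
InIdeal l = l ≡ X ⊎ l ≡ Z

HeadInIdeal : ∀ {n} → ℤ × Word (suc n) → Set
HeadInIdeal (_ , w) = InIdeal (head w)

mulL-inIdealˡ : ∀ {x} y → InIdeal x → InIdeal (proj₂ (mulL x y))
mulL-inIdealˡ X (inj₁ refl) = inj₂ refl
mulL-inIdealˡ Y (inj₁ refl) = inj₁ refl
mulL-inIdealˡ Z (inj₁ refl) = inj₂ refl
mulL-inIdealˡ X (inj₂ refl) = inj₂ refl
mulL-inIdealˡ Y (inj₂ refl) = inj₂ refl
mulL-inIdealˡ Z (inj₂ refl) = inj₂ refl

chainW-headInIdeal : ∀ {a b} (w : Word (suc a)) (w′ : Word (suc b)) →
  InIdeal (head w) → InIdeal (head (proj₂ (chainW w w′)))
chainW-headInIdeal {suc a} (x ∷ w) w′ p = p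
chainW-headInIdeal {zero} (x ∷ []) (y ∷ w′) p with mulL x y | mulL-inIdealˡ y p
... | _ , _ | q = q

chain-headInIdeal : ∀ {a b} (u : Tensor (suc a)) (v : Tensor (suc b)) →
  All HeadInIdeal u → All HeadInIdeal (chain u v)
chain-headInIdeal u v p = All.concat⁺ (All.map⁺ (All.map (λ {(_ , w)} q →
  All.map⁺ (All.universal (λ { (_ , w′) → chainW-headInIdeal w w′ q }) v)) p))

All-coeff≢0 : ∀ {n} {P : Word n → Set} (u : Tensor n) (w : Word n) →
  All (λ t → P (proj₂ t)) u → coeff u w ≢ + 0 → P w
All-coeff≢0 [] w [] c≢0 = ⊥-elim (c≢0 refl)
All-coeff≢0 ((c , v) ∷ u) w (p ∷ ps) c≢0 with Vec.≡-dec _≟L_ v w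
... | yes refl = p
... | no _ = All-coeff≢0 u w ps c≢0

lemma4p3 : (m : ℕ) → 1 ≤ m → (w : Word (suc (m + 0))) →
    coeff (XPX m) w ≢ + 0 → head w ≡ X ⊎ head w ≡ Z
lemma4p3 m _ w = All-coeff≢0 (XPX m) w XPX-headInIdeal
  where
  XPX-headInIdeal : All HeadInIdeal (XPX m)
  XPX-headInIdeal =
    chain-headInIdeal _ (elt X) (chain-headInIdeal (elt X) (Ppow m) (inj₁ refl ∷ []))
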